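{- Let $X$ be a site in which every object is quasi-compact, and let $\mathbf{E}$ be an elementary quasi-abelian category. Let $\mathcal{F}$ be an $\mathbf{E}$-valued presheaf on $X$ such that for every object $U$ and every finite covering $\mathfrak{U}$ of $U$ the sequence $$0\to\mathcal{F}(U)\to\prod_{V\in\mathfrak{U}}\mathcal{F}(V)\to\prod_{W,W'\in\mathfrak{U}}\mathcal{F}(W\times_UW')$$ is strictly exact. Then $\mathcal{F}$ is a sheaf.
   Context: An object $U$ of a site is quasi-compact if every covering of $U$ has a finite subcovering. A quasi-abelian category (Schneiders) is elementary if it is cocomplete and has a small strictly generating set of tiny projective objects. A sequence $0\to A\to B\to C$ in a quasi-abelian category is strictly exact if $A\to B$ is a kernel of $B\to C$. An $\mathbf{E}$-presheaf $\mathcal{F}:X^{\mathrm{op}}\to\mathbf{E}$ is a sheaf if the displayed sequence is strictly exact for every object $U$ and every covering $\mathfrak{U}$ of $U$. -}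

module Defs where

open import Level using (Level; _⊔_; suc; 0ℓ)
open import Data.Nat using (ℕ)
open import Data.Fin using (Fin)
open import Data.Bool using (Bool)
open import Data.Unit.Polymorphic using (⊤)
open import Data.Product using (Σ; Σ-syntax; _×_; _,_; proj₁; proj₂)
open import Relation.Binary using (Rel; IsEquivalence)
open import Algebra.Bundles using (AbelianGroup)
open import Algebra.Structures using (IsAbelianGroup)
open import Function.Bundles using (_↔_)

-- Categories (hom-setoids).  Obj at level o, Hom and equality at level h.
-- "Small" (for index sets, diagrams) means: living in Set h.

record Category (o h : Level) : Set (suc (o ⊔ h)) where
  infix  4 _≈_
  infixr 9 _∘_
  field
    Obj       : Set o
    Hom       : Obj → Obj → Set h
    _≈_       : ∀ {A B} → Rel (Hom A B) h
    ≈-equiv   : ∀ {A B} → IsEquivalence (_≈_ {A} {B})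
    id        : ∀ {A} → Hom A A
    _∘_       : ∀ {A B C} → Hom B C → Hom A B → Hom A C
    assoc     : ∀ {A B C D} {f : Hom A B} {g : Hom B C} {k : Hom C D} →
                (k ∘ g) ∘ f ≈ k ∘ (g ∘ f)
    identityˡ : ∀ {A B} {f : Hom A B} → id ∘ f ≈ f
    identityʳ : ∀ {A B} {f : Hom A B} → f ∘ id ≈ f
    ∘-resp-≈  : ∀ {A B C} {f g : Hom B C} {u v : Hom A B} →
                f ≈ g → u ≈ v → f ∘ u ≈ g ∘ v

record Functor {o₁ h₁ o₂ h₂} (J : Category o₁ h₁) (C : Category o₂ h₂)
       : Set (o₁ ⊔ h₁ ⊔ o₂ ⊔ h₂) where
  private
    module J = Category J
    module C = Category C
  field
    F₀       : J.Obj → C.Obj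
    F₁       : ∀ {A B} → J.Hom A B → C.Hom (F₀ A) (F₀ B)
    F-resp-≈ : ∀ {A B} {f g : J.Hom A B} → f J.≈ g → F₁ f C.≈ F₁ g
    F-id     : ∀ {A} → F₁ (J.id {A}) C.≈ C.id
    F-∘      : ∀ {A B D} {f : J.Hom A B} {g : J.Hom B D} →
               F₁ (g J.∘ f) C.≈ (F₁ g C.∘ F₁ f)

module CatNotions {o h : Level} (C : Category o h) where
  open Category C

  record IsIso {A B : Obj} (f : Hom A B) : Set h where
    field
      inv   : Hom B A
      isoˡ  : inv ∘ f ≈ id
      isoʳ  : f ∘ inv ≈ id

  record IsProduct {ι : Level} {I : Set ι} (X : I → Obj) (P : Obj)
                   (π : (i : I) → Hom P (X i)) : Set (o ⊔ h ⊔ ι) where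
    field
      ⟨_⟩     : ∀ {T} → ((i : I) → Hom T (X i)) → Hom T P
      project : ∀ {T} (f : (i : I) → Hom T (X i)) (i : I) → π i ∘ ⟨ f ⟩ ≈ f i
      unique  : ∀ {T} (f : (i : I) → Hom T (X i)) (u : Hom T P) →
                ((i : I) → π i ∘ u ≈ f i) → u ≈ ⟨ f ⟩

  record IsCoproduct {ι : Level} {I : Set ι} (X : I → Obj) (S : Obj)
                     (inj : (i : I) → Hom (X i) S) : Set (o ⊔ h ⊔ ι) where
    field
      [_]      : ∀ {T} → ((i : I) → Hom (X i) T) → Hom S T
      inject   : ∀ {T} (f : (i : I) → Hom (X i) T) (i : I) → [ f ] ∘ inj i ≈ f i
      unique   : ∀ {T} (f : (i : I) → Hom (X i) T) (u : Hom S T) →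
                 ((i : I) → u ∘ inj i ≈ f i) → u ≈ [ f ]

  record IsPullback {P A B Z : Obj} (f : Hom A Z) (g : Hom B Z)
                    (p₁ : Hom P A) (p₂ : Hom P B) : Set (o ⊔ h) where
    field
      commute   : f ∘ p₁ ≈ g ∘ p₂
      universal : ∀ {T} (a : Hom T A) (b : Hom T B) → f ∘ a ≈ g ∘ b → Hom T P
      p₁∘univ   : ∀ {T} (a : Hom T A) (b : Hom T B) (eq : f ∘ a ≈ g ∘ b) →
                  p₁ ∘ universal a b eq ≈ a
      p₂∘univ   : ∀ {T} (a : Hom T A) (b : Hom T B) (eq : f ∘ a ≈ g ∘ b) →
                  p₂ ∘ universal a b eq ≈ b
      unique    : ∀ {T} (a : Hom T A) (b : Hom T B) (eq : f ∘ a ≈ g ∘ b)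
                  (u : Hom T P) → p₁ ∘ u ≈ a → p₂ ∘ u ≈ b →
                  u ≈ universal a b eq

  record Pullback {A B Z : Obj} (f : Hom A Z) (g : Hom B Z) : Set (o ⊔ h) where
    field
      P          : Obj
      p₁         : Hom P A
      p₂         : Hom P B
      isPullback : IsPullback f g p₁ p₂

  record IsPushout {Q A B A' : Obj} (f : Hom A B) (g : Hom A A')
                   (q₁ : Hom B Q) (q₂ : Hom A' Q) : Set (o ⊔ h) where
    field
      commute   : q₁ ∘ f ≈ q₂ ∘ g
      universal : ∀ {T} (a : Hom B T) (b : Hom A' T) → a ∘ f ≈ b ∘ g → Hom Q T
      univ∘q₁   : ∀ {T} (a : Hom B T) (b : Hom A' T) (eq : a ∘ f ≈ b ∘ g) →
                  universal a b eq ∘ q₁ ≈ a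
      univ∘q₂   : ∀ {T} (a : Hom B T) (b : Hom A' T) (eq : a ∘ f ≈ b ∘ g) →
                  universal a b eq ∘ q₂ ≈ b
      unique    : ∀ {T} (a : Hom B T) (b : Hom A' T) (eq : a ∘ f ≈ b ∘ g)
                  (u : Hom Q T) → u ∘ q₁ ≈ a → u ∘ q₂ ≈ b →
                  u ≈ universal a b eq

  record IsColimit (J : Category h h) (D : Functor J C) (L : Obj)
                   (λ' : (j : Category.Obj J) → Hom (Functor.F₀ D j) L)
                   : Set (o ⊔ h) where
    private
      module J = Category J
      module D = Functor D
    field
      cocone    : ∀ {j k} (u : J.Hom j k) → λ' k ∘ D.F₁ u ≈ λ' j
      factor    : ∀ {T} (t : (j : J.Obj) → Hom (D.F₀ j) T) →
                  (∀ {j k} (u : J.Hom j k) → t k ∘ D.F₁ u ≈ t j) → Hom L T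
      factor-∘  : ∀ {T} (t : (j : J.Obj) → Hom (D.F₀ j) T)
                  (com : ∀ {j k} (u : J.Hom j k) → t k ∘ D.F₁ u ≈ t j)
                  (j : J.Obj) → factor t com ∘ λ' j ≈ t j
      unique    : ∀ {T} (t : (j : J.Obj) → Hom (D.F₀ j) T)
                  (com : ∀ {j k} (u : J.Hom j k) → t k ∘ D.F₁ u ≈ t j)
                  (m : Hom L T) → ((j : J.Obj) → m ∘ λ' j ≈ t j) →
                  m ≈ factor t com

  Cocomplete : Set (o ⊔ suc h)
  Cocomplete = (J : Category h h) (D : Functor J C) →
               Σ Obj λ L → Σ ((j : Category.Obj J) → Hom (Functor.F₀ D j) L)
                 λ λ' → IsColimit J D L λ'

record Preadditive {o h : Level} (C : Category o h) : Set (o ⊔ h) where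
  open Category C
  infixl 6 _+_ _-_
  field
    _+_    : ∀ {A B} → Hom A B → Hom A B → Hom A B
    0h     : ∀ {A B} → Hom A B
    -_     : ∀ {A B} → Hom A B → Hom A B
    isAbelianGroup : ∀ {A B} → IsAbelianGroup (_≈_ {A} {B}) _+_ 0h -_
    ∘-distribˡ : ∀ {A B D} (f : Hom B D) (g k : Hom A B) →
                 f ∘ (g + k) ≈ (f ∘ g) + (f ∘ k)
    ∘-distribʳ : ∀ {A B D} (f g : Hom B D) (k : Hom A B) →
                 (f + g) ∘ k ≈ (f ∘ k) + (g ∘ k)
  _-_ : ∀ {A B} → Hom A B → Hom A B → Hom A B
  f - g = f + (- g)

  HomGroup : Obj → Obj → AbelianGroup h h
  HomGroup A B = record { isAbelianGroup = isAbelianGroup {A} {B} }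

module AddNotions {o h : Level} (C : Category o h) (PA : Preadditive C) where
  open Category C
  open Preadditive PA
  open CatNotions C

  record IsKernel {K B D : Obj} (k : Hom K B) (f : Hom B D) : Set (o ⊔ h) where
    field
      compose-zero : f ∘ k ≈ 0h
      lift         : ∀ {T} (t : Hom T B) → f ∘ t ≈ 0h → Hom T K
      lift-∘       : ∀ {T} (t : Hom T B) (z : f ∘ t ≈ 0h) → k ∘ lift t z ≈ t
      lift-unique  : ∀ {T} (t : Hom T B) (z : f ∘ t ≈ 0h) (s : Hom T K) →
                     k ∘ s ≈ t → s ≈ lift t z

  record IsCokernel {A B Q : Obj} (c : Hom B Q) (f : Hom A B) : Set (o ⊔ h) where
    field
      compose-zero : c ∘ f ≈ 0h
      desc         : ∀ {T} (t : Hom B T) → t ∘ f ≈ 0h → Hom Q T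
      desc-∘       : ∀ {T} (t : Hom B T) (z : t ∘ f ≈ 0h) → desc t z ∘ c ≈ t
      desc-unique  : ∀ {T} (t : Hom B T) (z : t ∘ f ≈ 0h) (s : Hom Q T) →
                     s ∘ c ≈ t → s ≈ desc t z

  StrictEpi : ∀ {B Q} → Hom B Q → Set (o ⊔ h)
  StrictEpi {B} c = Σ Obj λ A → Σ (Hom A B) λ f → IsCokernel c f

  StrictMono : ∀ {K B} → Hom K B → Set (o ⊔ h)
  StrictMono {K} {B} k = Σ Obj λ D → Σ (Hom B D) λ f → IsKernel k f

  record IsZeroObject (Z : Obj) : Set (o ⊔ h) where
    field
      from        : ∀ A → Hom Z A
      from-unique : ∀ {A} (f : Hom Z A) → f ≈ from A
      to          : ∀ A → Hom A Z
      to-unique   : ∀ {A} (f : Hom A Z) → f ≈ to A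

  record IsHomToGroup {ℓ₁ ℓ₂} {A B : Obj} (G : AbelianGroup ℓ₁ ℓ₂)
         (φ : Hom A B → AbelianGroup.Carrier G) : Set (h ⊔ ℓ₁ ⊔ ℓ₂) where
    private module G = AbelianGroup G
    field
      φ-resp-≈ : ∀ {f g} → f ≈ g → φ f G.≈ φ g
      φ-+      : ∀ f g → φ (f + g) G.≈ (φ f G.∙ φ g)

  -- Hom(P , -) commutes with small direct sums: for every small coproduct
  -- (S , inj) of a family X, the abelian group Hom(P,S) with the maps
  -- inj i ∘ - : Hom(P, X i) → Hom(P,S) is a direct sum (coproduct in Ab)
  -- of the groups Hom(P, X i).
  IsTiny : Obj → Set (o ⊔ suc h)
  IsTiny P =
    ∀ {I : Set h} (X : I → Obj) (S : Obj) (inj : (i : I) → Hom (X i) S) →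
    IsCoproduct X S inj →
    (G : AbelianGroup h h) (φ : (i : I) → Hom P (X i) → AbelianGroup.Carrier G) →
    ((i : I) → IsHomToGroup G (φ i)) →
    Σ (Hom P S → AbelianGroup.Carrier G) λ Φ →
      IsHomToGroup G Φ
      × ((i : I) (g : Hom P (X i)) → AbelianGroup._≈_ G (Φ (inj i ∘ g)) (φ i g))
      × ((Ψ : Hom P S → AbelianGroup.Carrier G) → IsHomToGroup G Ψ →
         ((i : I) (g : Hom P (X i)) → AbelianGroup._≈_ G (Ψ (inj i ∘ g)) (φ i g)) →
         (f : Hom P S) → AbelianGroup._≈_ G (Ψ f) (Φ f))

  IsProjective : Obj → Set (o ⊔ h)
  IsProjective P = ∀ {A B} (e : Hom A B) → StrictEpi e →
                   (f : Hom P B) → Σ (Hom P A) λ g → e ∘ g ≈ f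

record QuasiAbelian {o h : Level} (C : Category o h) : Set (o ⊔ suc h) where
  open Category C
  open CatNotions C
  field
    preadditive : Preadditive C
  open AddNotions C preadditive
  field
    zeroObj     : Obj
    isZero      : IsZeroObject zeroObj
    binProduct  : (X : Bool → Obj) →
                  Σ Obj λ P → Σ ((b : Bool) → Hom P (X b)) λ π → IsProduct X P π
    kernel      : ∀ {B D} (f : Hom B D) →
                  Σ Obj λ K → Σ (Hom K B) λ k → IsKernel k f
    cokernel    : ∀ {A B} (f : Hom A B) →
                  Σ Obj λ Q → Σ (Hom B Q) λ c → IsCokernel c f
    strictEpi-pullback :
      ∀ {P A B B'} (f : Hom A B) (g : Hom B' B) (p₁ : Hom P A) (p₂ : Hom P B') →
      StrictEpi f → IsPullback f g p₁ p₂ → StrictEpi p₂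
    strictMono-pushout :
      ∀ {Q A B A'} (f : Hom A B) (g : Hom A A') (q₁ : Hom B Q) (q₂ : Hom A' Q) →
      StrictMono f → IsPushout f g q₁ q₂ → StrictMono q₂

record Elementary {o h : Level} (C : Category o h) (QA : QuasiAbelian C)
       : Set (o ⊔ suc h) where
  open Category C
  open CatNotions C
  open QuasiAbelian QA
  open AddNotions C preadditive
  field
    cocomplete : Cocomplete
    GenIdx     : Set h
    gen        : GenIdx → Obj
    gen-tiny   : (s : GenIdx) → IsTiny (gen s)
    gen-proj   : (s : GenIdx) → IsProjective (gen s)
    -- strictly generating: for every X, the canonical morphism
    --   ⊕_{(s , u : gen s → X)} gen s  →  X   is a strict epimorphism
    strictly-generating :
      (X : Obj) →
      Σ Obj λ S →
      Σ ((su : Σ GenIdx λ s → Hom (gen s) X) → Hom (gen (proj₁ su)) S) λ inj →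
      IsCoproduct (λ su → gen (proj₁ su)) S inj ×
      Σ (Hom S X) λ e → ((su : Σ GenIdx λ s → Hom (gen s) X) → e ∘ inj su ≈ proj₂ su)
                        × StrictEpi e

module FamilyNotions {o h : Level} (C : Category o h) where
  open Category C
  open CatNotions C

  record Family (U : Obj) : Set (o ⊔ suc h) where
    field
      Idx : Set h
      dom : Idx → Obj
      arr : (i : Idx) → Hom (dom i) U

  singleton : ∀ {V U} → Hom V U → Family U
  singleton {V} f = record { Idx = ⊤ ; dom = λ _ → V ; arr = λ _ → f }

  restrict : ∀ {U} (𝔘 : Family U) {n : ℕ} → (Fin n → Family.Idx 𝔘) → Family U
  restrict 𝔘 {n} σ = record { Idx = Lift' (Fin n)
                            ; dom = λ k → Family.dom 𝔘 (σ (Level.lower k))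
                            ; arr = λ k → Family.arr 𝔘 (σ (Level.lower k)) }
    where Lift' = Level.Lift h

  compose : ∀ {U} (𝔘 : Family U) →
            ((i : Family.Idx 𝔘) → Family (Family.dom 𝔘 i)) → Family U
  compose 𝔘 𝔙 = record
    { Idx = Σ (Family.Idx 𝔘) λ i → Family.Idx (𝔙 i)
    ; dom = λ ij → Family.dom (𝔙 (proj₁ ij)) (proj₂ ij)
    ; arr = λ ij → Family.arr 𝔘 (proj₁ ij) ∘ Family.arr (𝔙 (proj₁ ij)) (proj₂ ij) }

  IsFinite : ∀ {U} → Family U → Set h
  IsFinite 𝔘 = Σ ℕ λ n → Fin n ↔ Family.Idx 𝔘

record Site (o h : Level) : Set (suc (o ⊔ h)) where
  field
    cat : Category o h
  open Category cat
  open CatNotions cat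
  open FamilyNotions cat
  field
    pullback : ∀ {A B Z} (f : Hom A Z) (g : Hom B Z) → Pullback f g
  pullbackFamily : ∀ {U V} → Family U → Hom V U → Family V
  pullbackFamily 𝔘 g = record
    { Idx = Family.Idx 𝔘
    ; dom = λ i → Pullback.P (pullback (Family.arr 𝔘 i) g)
    ; arr = λ i → Pullback.p₂ (pullback (Family.arr 𝔘 i) g) }
  field
    Cov        : (U : Obj) → Family U → Set (o ⊔ h)
    cov-iso    : ∀ {V U} (f : Hom V U) → IsIso f → Cov U (singleton f)
    cov-stable : ∀ {U V} (𝔘 : Family U) → Cov U 𝔘 → (g : Hom V U) →
                 Cov V (pullbackFamily 𝔘 g)
    cov-trans  : ∀ {U} (𝔘 : Family U) → Cov U 𝔘 →
                 (𝔙 : (i : Family.Idx 𝔘) → Family (Family.dom 𝔘 i)) →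
                 ((i : Family.Idx 𝔘) → Cov (Family.dom 𝔘 i) (𝔙 i)) →
                 Cov U (compose 𝔘 𝔙)

  QuasiCompact : Obj → Set (o ⊔ suc h)
  QuasiCompact U = (𝔘 : Family U) → Cov U 𝔘 →
                   Σ ℕ λ n → Σ (Fin n → Family.Idx 𝔘) λ σ → Cov U (restrict 𝔘 σ)

record Presheaf {o₁ o₂ h : Level} (X : Site o₁ h) (E : Category o₂ h)
       : Set (o₁ ⊔ o₂ ⊔ h) where
  private
    module X = Category (Site.cat X)
    module E = Category E
  field
    F₀       : X.Obj → E.Obj
    F₁       : ∀ {V U} → X.Hom V U → E.Hom (F₀ U) (F₀ V)
    F-resp-≈ : ∀ {V U} {f g : X.Hom V U} → f X.≈ g → F₁ f E.≈ F₁ g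
    F-id     : ∀ {U} → F₁ (X.id {U}) E.≈ E.id
    F-∘      : ∀ {W V U} {f : X.Hom W V} {g : X.Hom V U} →
               F₁ (g X.∘ f) E.≈ (F₁ f E.∘ F₁ g)

module SheafNotions {o₁ o₂ h : Level} (X : Site o₁ h) (E : Category o₂ h)
                    (PA : Preadditive E) where
  open Site X using (cat; pullback; Cov)
  module X = Category cat
  open Category E
  open CatNotions E
  open Preadditive PA
  open AddNotions E PA
  open FamilyNotions cat
  open Presheaf

  -- The sequence
  --   0 → F(U) → ∏_{V∈𝔘} F(V) → ∏_{W,W'∈𝔘} F(W ×_U W')
  -- is strictly exact, i.e. the first map is a kernel of the second, for
  -- any choice of the products.
  SheafSequenceStrictlyExact : Presheaf X E → (U : X.Obj) → Family U → Set (o₂ ⊔ h)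
  SheafSequenceStrictlyExact F U 𝔘 =
    (P : Obj) (π : (i : I) → Hom P (F₀ F (dom i))) (prodP : IsProduct (λ i → F₀ F (dom i)) P π)
    (Q : Obj) (ρ : (ij : I × I) → Hom Q (F₀ F (W ij)))
    (prodQ : IsProduct (λ ij → F₀ F (W ij)) Q ρ) →
    IsKernel (IsProduct.⟨_⟩ prodP (λ i → F₁ F (arr i)))
             (IsProduct.⟨_⟩ prodQ (λ ij →
                 (F₁ F (pr₁ ij) ∘ π (proj₁ ij)) - (F₁ F (pr₂ ij) ∘ π (proj₂ ij))))
    where
      open Family 𝔘
      I = Idx
      W : I × I → X.Obj
      W ij = CatNotions.Pullback.P (pullback (arr (proj₁ ij)) (arr (proj₂ ij)))
      pr₁ : (ij : I × I) → X.Hom (W ij) (dom (proj₁ ij))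
      pr₁ ij = CatNotions.Pullback.p₁ (pullback (arr (proj₁ ij)) (arr (proj₂ ij)))
      pr₂ : (ij : I × I) → X.Hom (W ij) (dom (proj₂ ij))
      pr₂ ij = CatNotions.Pullback.p₂ (pullback (arr (proj₁ ij)) (arr (proj₂ ij)))

  IsSheaf : Presheaf X E → Set (o₁ ⊔ o₂ ⊔ suc h)
  IsSheaf F = (U : X.Obj) (𝔘 : Family U) → Cov U 𝔘 → SheafSequenceStrictlyExact F U 𝔘

-- Strict exactness of 0 → F(U) → ∏ F(Vᵢ) → ∏ F(Vᵢ ×_U Vⱼ) says exactly that F has unique
-- gluing of compatible generalised sections along the covering.  Given an arbitrary covering,
-- quasi-compactness yields a finite subcovering 𝔘′; compatible sections on 𝔘 glue on 𝔘′, and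
-- the glued section restricts correctly to each Vᵢ because the pullback of 𝔘′ to Vᵢ is again a
-- finite covering, on which sections are separated.
module Submission where

open import Defs
open import Level using (Level; Lift; lift; lower; _⊔_)
open import Data.Nat using (zero; suc)
open import Data.Fin using (Fin; zero; suc)
open import Data.Bool using (true; false; if_then_else_)
open import Data.Product using (Σ; _×_; _,_; proj₁; proj₂)
open import Relation.Binary using (IsEquivalence; Setoid)
open import Relation.Binary.PropositionalEquality using (refl)
open import Function.Bundles using (_↔_; mk↔ₛ′)
open import Algebra.Bundles using (AbelianGroup)
import Algebra.Properties.Group as GroupProperties
import Relation.Binary.Reasoning.Setoid as SetoidReasoning

module HomReasoning {o h : Level} (C : Category o h) where
  open Category C

  homSetoid : Obj → Obj → Setoid h h
  homSetoid A B = record { isEquivalence = ≈-equiv {A} {B} }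

  module ≈ {A B : Obj} = IsEquivalence (≈-equiv {A} {B})
  open module Reasoning {A B : Obj} = SetoidReasoning (homSetoid A B) public

  infixr 4 _⟩∘⟨_ refl⟩∘⟨_
  infixl 5 _⟩∘⟨refl

  _⟩∘⟨_ : ∀ {A B D} {f g : Hom B D} {u v : Hom A B} → f ≈ g → u ≈ v → f ∘ u ≈ g ∘ v
  _⟩∘⟨_ = ∘-resp-≈

  refl⟩∘⟨_ : ∀ {A B D} {f : Hom B D} {u v : Hom A B} → u ≈ v → f ∘ u ≈ f ∘ v
  refl⟩∘⟨ e = ≈.refl ⟩∘⟨ e

  _⟩∘⟨refl : ∀ {A B D} {f g : Hom B D} {u : Hom A B} → f ≈ g → f ∘ u ≈ g ∘ u
  e ⟩∘⟨refl = e ⟩∘⟨ ≈.refl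

module PreadditiveProperties {o h : Level} {C : Category o h} (PA : Preadditive C) where
  open Category C
  open Preadditive PA
  open HomReasoning C
  module HomGroupProperties {A B : Obj} =
    GroupProperties (AbelianGroup.group (HomGroup A B))
  open HomGroupProperties public using (x≈y⇒x∙y⁻¹≈ε; x∙y⁻¹≈ε⇒x≈y)
  private
    module AG {A B : Obj} = AbelianGroup (HomGroup A B)

  ∘-zeroʳ : ∀ {A B D} (f : Hom B D) → f ∘ 0h {A} ≈ 0h
  ∘-zeroʳ f = HomGroupProperties.identityʳ-unique (f ∘ 0h) (f ∘ 0h) (begin
    f ∘ 0h + f ∘ 0h  ≈⟨ ∘-distribˡ f 0h 0h ⟨
    f ∘ (0h + 0h)    ≈⟨ refl⟩∘⟨ AG.identityʳ 0h ⟩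
    f ∘ 0h           ∎)

  ∘-zeroˡ : ∀ {A B D} (f : Hom A B) → 0h {B} {D} ∘ f ≈ 0h
  ∘-zeroˡ f = HomGroupProperties.identityʳ-unique (0h ∘ f) (0h ∘ f) (begin
    0h ∘ f + 0h ∘ f  ≈⟨ ∘-distribʳ 0h 0h f ⟨
    (0h + 0h) ∘ f    ≈⟨ AG.identityʳ 0h ⟩∘⟨refl ⟩
    0h ∘ f           ∎)

  -‿distribˡ-∘ : ∀ {A B D} (f : Hom B D) (g : Hom A B) → (- f) ∘ g ≈ - (f ∘ g)
  -‿distribˡ-∘ f g = HomGroupProperties.inverseˡ-unique ((- f) ∘ g) (f ∘ g) (begin
    (- f) ∘ g + f ∘ g  ≈⟨ ∘-distribʳ (- f) f g ⟨
    (- f + f) ∘ g      ≈⟨ AG.inverseˡ f ⟩∘⟨refl ⟩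
    0h ∘ g             ≈⟨ ∘-zeroˡ g ⟩
    0h                 ∎)

  ∘-distribʳ-− : ∀ {A B D} (f f' : Hom B D) (g : Hom A B) → (f - f') ∘ g ≈ f ∘ g - f' ∘ g
  ∘-distribʳ-− f f' g = begin
    (f - f') ∘ g          ≈⟨ ∘-distribʳ f (- f') g ⟩
    f ∘ g + (- f') ∘ g    ≈⟨ AG.∙-congˡ (-‿distribˡ-∘ f' g) ⟩
    f ∘ g - f' ∘ g        ∎

module Products {o h : Level} (C : Category o h) where
  open Category C
  open CatNotions C
  open HomReasoning C

  HasProduct : ∀ {ι} {I : Set ι} → (I → Obj) → Set (o ⊔ h ⊔ ι)
  HasProduct X = Σ Obj λ P → Σ (∀ i → Hom P (X i)) λ π → IsProduct X P π

  module _ {ι} {I : Set ι} {X : I → Obj} {P : Obj} {π : ∀ i → Hom P (X i)}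
           (isProduct : IsProduct X P π) where
    open IsProduct isProduct

    product-ext : ∀ {T} {u v : Hom T P} → (∀ i → π i ∘ u ≈ π i ∘ v) → u ≈ v
    product-ext {v = v} e = ≈.trans (unique _ _ e) (≈.sym (unique _ v (λ _ → ≈.refl)))

  Lift-product : ∀ {ι} ℓ {I : Set ι} (X : Lift ℓ I → Obj) → HasProduct (λ i → X (lift i)) →
                 HasProduct X
  Lift-product ℓ X (P , π , isProduct) = P , (λ k → π (lower k)) , record
    { ⟨_⟩     = λ f → ⟨ (λ i → f (lift i)) ⟩
    ; project = λ f k → project _ (lower k)
    ; unique  = λ f u e → unique _ u (λ i → e (lift i)) }
    where open IsProduct isProduct

  pair-product : ∀ {ι} {I : Set ι} → (∀ (X : I → Obj) → HasProduct X) →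
                 (Y : I × I → Obj) → HasProduct Y
  pair-product {I = I} products Y = P , π , record { ⟨_⟩ = tuple ; project = project ; unique = unique }
    where
      row : (i : I) → HasProduct (λ j → Y (i , j))
      row i = products (λ j → Y (i , j))
      module Row (i : I) = IsProduct (proj₂ (proj₂ (row i)))
      column = products (λ i → proj₁ (row i))
      module Column = IsProduct (proj₂ (proj₂ column))
      P = proj₁ column
      π : ∀ ij → Hom P (Y ij)
      π (i , j) = proj₁ (proj₂ (row i)) j ∘ proj₁ (proj₂ column) i
      tuple : ∀ {T} → (∀ ij → Hom T (Y ij)) → Hom T P
      tuple f = Column.⟨ (λ i → Row.⟨_⟩ i (λ j → f (i , j))) ⟩
      project : ∀ {T} (f : ∀ ij → Hom T (Y ij)) ij → π ij ∘ tuple f ≈ f ij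
      project f (i , j) = ≈.trans assoc (≈.trans (refl⟩∘⟨ Column.project _ i) (Row.project i _ j))
      unique : ∀ {T} (f : ∀ ij → Hom T (Y ij)) u → (∀ ij → π ij ∘ u ≈ f ij) → u ≈ tuple f
      unique f u e = Column.unique _ u λ i →
        Row.unique i _ _ (λ j → ≈.trans (≈.sym assoc) (e (i , j)))

module FiniteProducts {o h : Level} {C : Category o h} (QA : QuasiAbelian C) where
  open Category C
  open CatNotions C
  open HomReasoning C
  open Products C
  open QuasiAbelian QA using (zeroObj; isZero; binProduct)

  empty-product : (X : Fin 0 → Obj) → HasProduct X
  empty-product X = zeroObj , (λ ()) , record
    { ⟨_⟩ = λ _ → to _ ; project = λ _ () ; unique = λ _ u _ → to-unique u }
    where open AddNotions.IsZeroObject isZero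

  cons-product : ∀ {n} (X : Fin (suc n) → Obj) → HasProduct (λ i → X (suc i)) → HasProduct X
  cons-product X (P , π , isP) with binProduct (λ b → if b then X zero else P)
  ... | B , p , isB = B , π′ , record { ⟨_⟩ = tuple ; project = project ; unique = unique }
    where
      module P = IsProduct isP
      module B = IsProduct isB
      π′ : ∀ i → Hom B (X i)
      π′ zero    = p true
      π′ (suc i) = π i ∘ p false
      split : ∀ {T} → (∀ i → Hom T (X i)) → ∀ b → Hom T (if b then X zero else P)
      split f true  = f zero
      split f false = P.⟨ (λ i → f (suc i)) ⟩
      tuple : ∀ {T} → (∀ i → Hom T (X i)) → Hom T B
      tuple f = B.⟨ split f ⟩
      project : ∀ {T} (f : ∀ i → Hom T (X i)) i → π′ i ∘ tuple f ≈ f i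
      project f zero    = B.project (split f) true
      project f (suc i) = begin
        (π i ∘ p false) ∘ tuple f  ≈⟨ assoc ⟩
        π i ∘ (p false ∘ tuple f)  ≈⟨ refl⟩∘⟨ B.project (split f) false ⟩
        π i ∘ split f false        ≈⟨ P.project _ i ⟩
        f (suc i)                  ∎
      unique : ∀ {T} (f : ∀ i → Hom T (X i)) u → (∀ i → π′ i ∘ u ≈ f i) → u ≈ tuple f
      unique f u e = B.unique (split f) u λ where
        true  → e zero
        false → P.unique _ _ (λ i → ≈.trans (≈.sym assoc) (e (suc i)))

  Fin-product : ∀ n (X : Fin n → Obj) → HasProduct X
  Fin-product zero    X = empty-product X
  Fin-product (suc n) X = cons-product X (Fin-product n (λ i → X (suc i)))

module Gluing {o₁ o₂ h : Level} (X : Site o₁ h) {E : Category o₂ h} (PA : Preadditive E)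
              (F : Presheaf X E) where
  open Site X using (cat; pullback; pullbackFamily)
  private module X = Category cat
  open Category E
  open CatNotions E
  open Preadditive PA
  open AddNotions E PA
  open FamilyNotions cat
  open Presheaf F
  open HomReasoning E
  open PreadditiveProperties PA
  open Products E

  F-square : ∀ {P A B Z} {f : X.Hom A Z} {g : X.Hom B Z} {p₁ : X.Hom P A} {p₂ : X.Hom P B} →
             f X.∘ p₁ X.≈ g X.∘ p₂ → F₁ p₁ ∘ F₁ f ≈ F₁ p₂ ∘ F₁ g
  F-square {f = f} {g} {p₁} {p₂} e = begin
    F₁ p₁ ∘ F₁ f     ≈⟨ F-∘ ⟨
    F₁ (f X.∘ p₁)    ≈⟨ F-resp-≈ e ⟩
    F₁ (g X.∘ p₂)    ≈⟨ F-∘ ⟩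
    F₁ p₂ ∘ F₁ g     ∎

  module _ {V : X.Obj} (𝔙 : Family V) where
    open Family 𝔙

    intersection : (ij : Idx × Idx) → CatNotions.Pullback cat (arr (proj₁ ij)) (arr (proj₂ ij))
    intersection (i , j) = pullback (arr i) (arr j)

    W : Idx × Idx → X.Obj
    W ij = CatNotions.Pullback.P (intersection ij)

    pr₁ : (ij : Idx × Idx) → X.Hom (W ij) (dom (proj₁ ij))
    pr₁ ij = CatNotions.Pullback.p₁ (intersection ij)

    pr₂ : (ij : Idx × Idx) → X.Hom (W ij) (dom (proj₂ ij))
    pr₂ ij = CatNotions.Pullback.p₂ (intersection ij)

    -- Sections are generalised elements T → F(−), so that no concrete category is needed.
    Compatible : ∀ {T} → (∀ i → Hom T (F₀ (dom i))) → Set h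
    Compatible t = ∀ i j → F₁ (pr₁ (i , j)) ∘ t i ≈ F₁ (pr₂ (i , j)) ∘ t j

    Separated : Set (o₂ ⊔ h)
    Separated = ∀ {T} {s s′ : Hom T (F₀ V)} →
                (∀ i → F₁ (arr i) ∘ s ≈ F₁ (arr i) ∘ s′) → s ≈ s′

    record UniqueGluing : Set (o₂ ⊔ h) where
      field
        separated     : Separated
        glue          : ∀ {T} (t : ∀ i → Hom T (F₀ (dom i))) → Compatible t → Hom T (F₀ V)
        restrict-glue : ∀ {T} (t : ∀ i → Hom T (F₀ (dom i))) (c : Compatible t) i →
                        F₁ (arr i) ∘ glue t c ≈ t i

    Compatible-resp : ∀ {T} {t t′ : ∀ i → Hom T (F₀ (dom i))} →
                      (∀ i → t i ≈ t′ i) → Compatible t → Compatible t′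
    Compatible-resp e c i j = begin
      F₁ (pr₁ (i , j)) ∘ _  ≈⟨ refl⟩∘⟨ e i ⟨
      F₁ (pr₁ (i , j)) ∘ _  ≈⟨ c i j ⟩
      F₁ (pr₂ (i , j)) ∘ _  ≈⟨ refl⟩∘⟨ e j ⟩
      F₁ (pr₂ (i , j)) ∘ _  ∎

    Compatible-restrictions : Compatible (λ i → F₁ (arr i))
    Compatible-restrictions i j =
      F-square (CatNotions.IsPullback.commute (CatNotions.Pullback.isPullback (intersection (i , j))))

    module SheafSequence {P : Obj} {π : ∀ i → Hom P (F₀ (dom i))}
                         (isP : IsProduct (λ i → F₀ (dom i)) P π)
                         {Q : Obj} {ρ : ∀ ij → Hom Q (F₀ (W ij))}
                         (isQ : IsProduct (λ ij → F₀ (W ij)) Q ρ) where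
      private
        module P = IsProduct isP
        module Q = IsProduct isQ

      restriction : Hom (F₀ V) P
      restriction = P.⟨ (λ i → F₁ (arr i)) ⟩

      difference : Hom P Q
      difference = Q.⟨ (λ ij → F₁ (pr₁ ij) ∘ π (proj₁ ij) - F₁ (pr₂ ij) ∘ π (proj₂ ij)) ⟩

      π∘restriction : ∀ {T} (s : Hom T (F₀ V)) i → π i ∘ (restriction ∘ s) ≈ F₁ (arr i) ∘ s
      π∘restriction s i = ≈.trans (≈.sym assoc) (P.project _ i ⟩∘⟨refl)

      ρ∘difference : ∀ {T} (t : Hom T P) i j →
                     ρ (i , j) ∘ (difference ∘ t) ≈
                     F₁ (pr₁ (i , j)) ∘ (π i ∘ t) - F₁ (pr₂ (i , j)) ∘ (π j ∘ t)
      ρ∘difference t i j = begin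
        ρ (i , j) ∘ (difference ∘ t)                             ≈⟨ assoc ⟨
        (ρ (i , j) ∘ difference) ∘ t                             ≈⟨ Q.project _ (i , j) ⟩∘⟨refl ⟩
        (F₁ (pr₁ (i , j)) ∘ π i - F₁ (pr₂ (i , j)) ∘ π j) ∘ t    ≈⟨ ∘-distribʳ-− _ _ t ⟩
        (F₁ (pr₁ (i , j)) ∘ π i) ∘ t - (F₁ (pr₂ (i , j)) ∘ π j) ∘ t
          ≈⟨ AbelianGroup.∙-cong (HomGroup _ _) assoc (AbelianGroup.⁻¹-cong (HomGroup _ _) assoc) ⟩
        F₁ (pr₁ (i , j)) ∘ (π i ∘ t) - F₁ (pr₂ (i , j)) ∘ (π j ∘ t) ∎

      compatible⇒difference∘≈0 : ∀ {T} (t : Hom T P) → Compatible (λ i → π i ∘ t) →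
                                 difference ∘ t ≈ 0h
      compatible⇒difference∘≈0 t c = product-ext isQ λ (i , j) → begin
        ρ (i , j) ∘ (difference ∘ t)  ≈⟨ ρ∘difference t i j ⟩
        _                             ≈⟨ x≈y⇒x∙y⁻¹≈ε (c i j) ⟩
        0h                            ≈⟨ ∘-zeroʳ (ρ (i , j)) ⟨
        ρ (i , j) ∘ 0h                ∎

      difference∘≈0⇒compatible : ∀ {T} (t : Hom T P) → difference ∘ t ≈ 0h →
                                 Compatible (λ i → π i ∘ t)
      difference∘≈0⇒compatible t z i j = x∙y⁻¹≈ε⇒x≈y _ _ (begin
        _                             ≈⟨ ρ∘difference t i j ⟨
        ρ (i , j) ∘ (difference ∘ t)  ≈⟨ refl⟩∘⟨ z ⟩
        ρ (i , j) ∘ 0h                ≈⟨ ∘-zeroʳ (ρ (i , j)) ⟩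
        0h                            ∎)

      kernel⇒uniqueGluing : IsKernel restriction difference → UniqueGluing
      kernel⇒uniqueGluing K = record
        { separated     = separated
        ; glue          = λ t c → K.lift P.⟨ t ⟩ (difference∘tuple≈0 t c)
        ; restrict-glue = λ t c i → begin
            F₁ (arr i) ∘ K.lift _ _              ≈⟨ π∘restriction _ i ⟨
            π i ∘ (restriction ∘ K.lift _ _)     ≈⟨ refl⟩∘⟨ K.lift-∘ _ _ ⟩
            π i ∘ P.⟨ t ⟩                        ≈⟨ P.project t i ⟩
            t i                                  ∎ }
        where
          module K = IsKernel K

          difference∘tuple≈0 : ∀ {T} (t : ∀ i → Hom T (F₀ (dom i))) → Compatible t →
                               difference ∘ P.⟨ t ⟩ ≈ 0h
          difference∘tuple≈0 t c =
            compatible⇒difference∘≈0 _ (Compatible-resp (λ i → ≈.sym (P.project t i)) c)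

          -- A kernel is a monomorphism, and restriction ∘ s records all F₁ (arr i) ∘ s.
          separated : Separated
          separated {s = s} {s′} e = ≈.trans (K.lift-unique _ z s ≈.refl)
                                             (≈.sym (K.lift-unique _ z s′ restriction∘s′))
            where
              z : difference ∘ (restriction ∘ s) ≈ 0h
              z = ≈.trans (≈.sym assoc) (≈.trans (K.compose-zero ⟩∘⟨refl) (∘-zeroˡ s))
              restriction∘s′ : restriction ∘ s′ ≈ restriction ∘ s
              restriction∘s′ = product-ext isP λ i →
                ≈.trans (π∘restriction s′ i) (≈.trans (≈.sym (e i)) (≈.sym (π∘restriction s i)))

      uniqueGluing⇒kernel : UniqueGluing → IsKernel restriction difference
      uniqueGluing⇒kernel G = record
        { compose-zero = compatible⇒difference∘≈0 restriction
                           (Compatible-resp (λ i → ≈.sym (P.project _ i)) Compatible-restrictions)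
        ; lift         = glue′
        ; lift-∘       = λ t z → product-ext isP λ i →
                           ≈.trans (π∘restriction (glue′ t z) i) (G.restrict-glue _ _ i)
        ; lift-unique  = λ t z s e → G.separated λ i → begin
            F₁ (arr i) ∘ s                ≈⟨ π∘restriction s i ⟨
            π i ∘ (restriction ∘ s)       ≈⟨ refl⟩∘⟨ e ⟩
            π i ∘ t                       ≈⟨ G.restrict-glue _ _ i ⟨
            F₁ (arr i) ∘ glue′ t z        ∎ }
        where
          module G = UniqueGluing G
          glue′ : ∀ {T} (t : Hom T P) → difference ∘ t ≈ 0h → Hom T (F₀ V)
          glue′ t z = G.glue (λ i → π i ∘ t) (difference∘≈0⇒compatible t z)

  strictlyExact⇒uniqueGluing : ∀ {V} (𝔙 : Family V) →
    (∀ (Y : Family.Idx 𝔙 → Obj) → HasProduct Y) →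
    SheafNotions.SheafSequenceStrictlyExact X E PA F V 𝔙 → UniqueGluing 𝔙
  strictlyExact⇒uniqueGluing 𝔙 products exact
    with products (λ i → F₀ (Family.dom 𝔙 i)) | pair-product products (λ ij → F₀ (W 𝔙 ij))
  ... | _ , _ , isP | _ , _ , isQ =
    SheafSequence.kernel⇒uniqueGluing 𝔙 isP isQ (exact _ _ isP _ _ isQ)

  uniqueGluing⇒strictlyExact : ∀ {V} (𝔙 : Family V) →
    UniqueGluing 𝔙 → SheafNotions.SheafSequenceStrictlyExact X E PA F V 𝔙
  uniqueGluing⇒strictlyExact 𝔙 G _ _ isP _ _ isQ = SheafSequence.uniqueGluing⇒kernel 𝔙 isP isQ G

  -- The glued section is checked on each Vᵢ after pulling the subfamily back to Vᵢ.
  uniqueGluing-from-subfamily : ∀ {U} (𝔘 : Family U) {n} (σ : Fin n → Family.Idx 𝔘) →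
    UniqueGluing (restrict 𝔘 σ) →
    (∀ i → Separated (pullbackFamily (restrict 𝔘 σ) (Family.arr 𝔘 i))) →
    UniqueGluing 𝔘
  uniqueGluing-from-subfamily 𝔘 σ G separatedᵢ = record
    { separated     = λ e → G.separated (λ k → e (σ (lower k)))
    ; glue          = λ t c → G.glue (λ k → t (σ (lower k))) (λ k l → c (σ (lower k)) (σ (lower l)))
    ; restrict-glue = restrict-glue }
    where
      open Family 𝔘
      module G = UniqueGluing G
      restrict-glue : ∀ {T} (t : ∀ i → Hom T (F₀ (dom i))) (c : Compatible 𝔘 t) i →
                      F₁ (arr i) ∘ G.glue _ _ ≈ t i
      restrict-glue t c i = separatedᵢ i agrees-on
        where
          s = G.glue (λ k → t (σ (lower k))) (λ k l → c (σ (lower k)) (σ (lower l)))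
          agrees-on : ∀ k → F₁ (pr₂ 𝔘 (σ (lower k) , i)) ∘ (F₁ (arr i) ∘ s) ≈
                            F₁ (pr₂ 𝔘 (σ (lower k) , i)) ∘ t i
          agrees-on k = begin
            F₁ q₂ ∘ (F₁ (arr i) ∘ s)                 ≈⟨ assoc ⟨
            (F₁ q₂ ∘ F₁ (arr i)) ∘ s                 ≈⟨ Compatible-restrictions 𝔘 (σ (lower k)) i ⟩∘⟨refl ⟨
            (F₁ q₁ ∘ F₁ (arr (σ (lower k)))) ∘ s     ≈⟨ assoc ⟩
            F₁ q₁ ∘ (F₁ (arr (σ (lower k))) ∘ s)     ≈⟨ refl⟩∘⟨ G.restrict-glue _ _ k ⟩
            F₁ q₁ ∘ t (σ (lower k))                  ≈⟨ c (σ (lower k)) i ⟩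
            F₁ q₂ ∘ t i                              ∎
            where
              q₁ = pr₁ 𝔘 (σ (lower k) , i)
              q₂ = pr₂ 𝔘 (σ (lower k) , i)

↔-Lift : ∀ {a} ℓ {A : Set a} → A ↔ Lift ℓ A
↔-Lift ℓ = mk↔ₛ′ lift lower (λ _ → refl) (λ _ → refl)

propositionA27 : {o₁ o₂ h : Level} (X : Site o₁ h) (E : Category o₂ h)
    (QA : QuasiAbelian E) (el : Elementary E QA) →
    ((U : Category.Obj (Site.cat X)) → Site.QuasiCompact X U) →
    (F : Presheaf X E) →
    ((U : Category.Obj (Site.cat X)) (𝔘 : FamilyNotions.Family (Site.cat X) U) →
    Site.Cov X U 𝔘 → FamilyNotions.IsFinite (Site.cat X) 𝔘 →
    SheafNotions.SheafSequenceStrictlyExact X E (QuasiAbelian.preadditive QA) F U 𝔘) →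
    SheafNotions.IsSheaf X E (QuasiAbelian.preadditive QA) F
propositionA27 {h = h} X E QA _ quasiCompact F finiteExact U 𝔘 cov
  with quasiCompact U 𝔘 cov
... | n , σ , subcover = uniqueGluing⇒strictlyExact 𝔘
        (uniqueGluing-from-subfamily 𝔘 σ
          (gluing 𝔘′ subcover (↔-Lift h) Lift-Fin-product) λ i →
          UniqueGluing.separated
            (gluing _ (cov-stable 𝔘′ subcover (Family.arr 𝔘 i)) (↔-Lift h) Lift-Fin-product))
  where
    open Category E using (Obj)
    open Site X using (Cov; cov-stable)
    open FamilyNotions (Site.cat X)
    open Gluing X (QuasiAbelian.preadditive QA) F
    open Products E using (HasProduct; Lift-product)
    open FiniteProducts QA using (Fin-product)

    𝔘′ = restrict 𝔘 σ

    Lift-Fin-product : (Y : Lift h (Fin n) → Obj) → HasProduct Y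
    Lift-Fin-product Y = Lift-product h Y (Fin-product n _)

    gluing : ∀ {V} (𝔙 : Family V) → Cov V 𝔙 → Fin n ↔ Family.Idx 𝔙 →
             (∀ (Y : Family.Idx 𝔙 → Obj) → HasProduct Y) → UniqueGluing 𝔙
    gluing 𝔙 covers finite products =
      strictlyExact⇒uniqueGluing 𝔙 products (finiteExact _ 𝔙 covers (n , finite))
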